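{- Let $\mathcal{H}=(V,\mathcal{E})$ be an $S(2,l,n)$ Steiner system, i.e. $|V|=n$, $\mathcal{E}$ is a family of $l$-subsets of $V$ and every pair of vertices is contained in exactly one member of $\mathcal{E}$ (so $m=|\mathcal{E}|=\binom{n}{2}/\binom{l}{2}$); write $\mathcal{E}=\{E_1,\dots,E_m\}$. Let $k\ge 3$, and for each $i=1,\dots,m$ let $\mathcal{F}_i=(E_i,\mathcal{E}_i)$ be a $k$-uniform hypergraph on vertex set $E_i$. (1) If there is a real number $\alpha$ with $|\mathcal{E}_i|=\alpha\binom{l}{2}$ for all $i$, then $\left|\bigcup_{i=1}^m\mathcal{E}_i\right|=\alpha\binom{n}{2}$. (2) If every $\mathcal{F}_i$ is an edge-minimal hypertree, then $\mathcal{F}=\left(V,\bigcup_{i=1}^m\mathcal{E}_i\right)$ is also an edge-minimal hypertree.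
   Context: A $k$-uniform hypergraph $\mathcal{H}=(V,\mathcal{E})$ consists of a finite vertex set $V$ and a set $\mathcal{E}$ of $k$-element subsets of $V$ (no multiple edges). A $k$-uniform hypergraph is a chain if there is a sequence $v_1,\dots,v_l$ of its vertices in which every vertex appears at least once (possibly more times), $v_1\ne v_l$, and its edge set consists of exactly the $l-k+1$ distinct sets $\{v_i,\dots,v_{i+k-1}\}$, $1\le i\le l-k+1$; it is a semicycle if the same holds with $v_1=v_l$ instead. $\mathcal{H}$ is chain-connected if every pair of distinct vertices is contained in some subhypergraph that is a chain; semicycle-free if no subhypergraph is a semicycle. A hypertree is a chain-connected, semicycle-free $k$-uniform hypergraph. An edge-minimal hypertree is a hypertree $(V,\mathcal{E})$ such that for every $e\in\mathcal{E}$, $(V,\mathcal{E}\setminus\{e\})$ is not a hypertree.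
   Formalization: The number α in part (1) is rational rather than real. -}

module Defs where

open import Data.Nat using (ℕ; zero; suc; _≤_; _≤?_)
open import Data.Bool using (Bool; true; false; T; _∧_; not)
open import Data.Fin using (Fin)
open import Data.Fin.Subset using (Subset; ⊥; ⁅_⁆; _∪_; _∈_; _⊆_; ∣_∣)
open import Data.List using (List; []; _∷_; _++_; map; take; length; filterᵇ; allFin)
open import Data.Bool.ListAction using (any)
open import Data.List.Relation.Unary.All using (All)
open import Data.List.Relation.Unary.Unique.Propositional using (Unique)
open import Data.List.Membership.Propositional using () renaming (_∈_ to _∈ˡ_)
import Data.Vec as V
open import Data.Vec.Properties using (≡-dec)
import Data.Bool.Properties as BoolP
open import Data.Product using (Σ; _×_; ∃; ∃-syntax)
open import Data.Integer using (+_)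
open import Data.Rational using (ℚ; _/_)
open import Relation.Nullary using (¬_; Dec; yes; no; ⌊_⌋)
open import Relation.Binary.PropositionalEquality using (_≡_; _≢_)

ℕtoℚ : ℕ → ℚ
ℕtoℚ n = (+ n) / 1

allSubsets : (n : ℕ) → List (Subset n)
allSubsets zero = V.[] ∷ []
allSubsets (suc n) = map (true V.∷_) (allSubsets n) ++ map (false V.∷_) (allSubsets n)

EdgeSet : ℕ → Set
EdgeSet n = Subset n → Bool

card : ∀ {n} → EdgeSet n → ℕ
card {n} E = length (filterᵇ E (allSubsets n))

_≟ˢ_ : ∀ {n} (s t : Subset n) → Dec (s ≡ t)
_≟ˢ_ = ≡-dec BoolP._≟_

_∖ₑ_ : ∀ {n} → EdgeSet n → Subset n → EdgeSet n
(E ∖ₑ e) f = E f ∧ not ⌊ f ≟ˢ e ⌋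

⋃ : ∀ {n m} → (Fin m → EdgeSet n) → EdgeSet n
⋃ {m = m} Ed e = any (λ i → Ed i e) (allFin m)

IsUniform : ∀ {n} → ℕ → Subset n → EdgeSet n → Set
IsUniform k W E = ∀ e → T (E e) → (e ⊆ W) × (∣ e ∣ ≡ k)

toSubset : ∀ {n} → List (Fin n) → Subset n
toSubset [] = ⊥
toSubset (x ∷ xs) = ⁅ x ⁆ ∪ toSubset xs

windows : ∀ {A : Set} → ℕ → List A → List (List A)
windows k [] = []
windows k (x ∷ xs) with k ≤? length (x ∷ xs)
... | yes _ = take k (x ∷ xs) ∷ windows k xs
... | no _ = []

seqLast : ∀ {A : Set} → A → List A → A
seqLast v [] = v
seqLast v (w ∷ ws) = seqLast w ws

-- The sequence vs = v_1 ... v_l (with l ≥ k) spans a sub-hypergraph of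
-- (W, E) whose edges are exactly the l-k+1 distinct k-sets
-- {v_i, ..., v_{i+k-1}}: all vertices lie in W, each window consists of
-- k distinct vertices, the windows give pairwise distinct sets, and each
-- of these sets is an edge of E.  (The vertex set of the sub-hypergraph
-- is the set of vertices occurring in vs.)
record WindowSeq {n} (k : ℕ) (W : Subset n) (E : EdgeSet n) (vs : List (Fin n)) : Set where
  field
    long     : k ≤ length vs
    inW      : All (_∈ W) vs
    kSets    : All (λ w → ∣ toSubset w ∣ ≡ k) (windows k vs)
    distinct : Unique (map toSubset (windows k vs))
    inE      : All (λ w → T (E (toSubset w))) (windows k vs)

IsChain : ∀ {n} → ℕ → Subset n → EdgeSet n → Fin n → List (Fin n) → Set
IsChain k W E v ws = WindowSeq k W E (v ∷ ws) × (v ≢ seqLast v ws)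

IsSemicycle : ∀ {n} → ℕ → Subset n → EdgeSet n → Fin n → List (Fin n) → Set
IsSemicycle k W E v ws = WindowSeq k W E (v ∷ ws) × (v ≡ seqLast v ws)

ChainConnected : ∀ {n} → ℕ → Subset n → EdgeSet n → Set
ChainConnected {n} k W E =
  ∀ (x y : Fin n) → x ∈ W → y ∈ W → x ≢ y →
  ∃[ v ] ∃[ ws ] (IsChain k W E v ws × x ∈ˡ (v ∷ ws) × y ∈ˡ (v ∷ ws))

SemicycleFree : ∀ {n} → ℕ → Subset n → EdgeSet n → Set
SemicycleFree {n} k W E = ∀ (v : Fin n) ws → ¬ IsSemicycle k W E v ws

IsHypertree : ∀ {n} → ℕ → Subset n → EdgeSet n → Set
IsHypertree k W E = IsUniform k W E × ChainConnected k W E × SemicycleFree k W E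

IsEdgeMinimalHypertree : ∀ {n} → ℕ → Subset n → EdgeSet n → Set
IsEdgeMinimalHypertree k W E =
  IsHypertree k W E × (∀ e → T (E e) → ¬ IsHypertree k W (E ∖ₑ e))

IsSteinerSystem : (n l m : ℕ) → (Fin m → Subset n) → Set
IsSteinerSystem n l m B =
  (∀ i → ∣ B i ∣ ≡ l) ×
  (∀ i j → B i ≡ B j → i ≡ j) ×
  (∀ (x y : Fin n) → x ≢ y →
     ∃[ i ] ((x ∈ B i × y ∈ B i) × (∀ j → x ∈ B j → y ∈ B j → j ≡ i)))

module Submission where

-- The blocks B i of the Steiner system are l-sets such that two distinct
-- vertices lie in exactly one block; hence a set with at least two
-- vertices lies in at most one block.  Every edge of the k-uniform
-- hypergraph F i is a k-subset of B i with k ≥ 2, so the edge sets Ed i are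
-- pairwise disjoint, and the edge count of their union ⋃ Ed is the sum of
-- the edge counts.  Counting 2-subsets of the vertex set the same way gives
-- n C 2 = m · (l C 2), which yields part (1).
--
-- For part (2) the key fact is a localisation lemma: in a sequence of
-- vertices whose k-windows are edges of ⋃ Ed, two consecutive windows share
-- k - 1 ≥ 2 vertices and therefore lie in the same block, so the whole
-- sequence lives in a single block B i and its windows are edges of Ed i.
-- Chains and semicycles of ⋃ Ed are thus chains and semicycles of one F i,
-- from which chain-connectedness, semicycle-freeness and edge-minimality of
-- the union follow from those of the F i.

open import Defs
open import Data.Nat using (ℕ; zero; suc; _≤_; _≤?_; _≡ᵇ_; z≤n; s≤s)
import Data.Nat as ℕ
import Data.Nat.Properties as ℕP
open import Data.Nat.Combinatorics using (_C_; nCk+nC[k+1]≡[n+1]C[k+1])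
open import Data.Nat.Coprimality using (1-coprimeTo) renaming (sym to coprime-sym)
open import Data.Integer using (+_)
import Data.Integer as ℤ
import Data.Integer.Properties as ℤP
open import Data.Rational using (ℚ; mkℚ; _/_; _+_; _*_)
import Data.Rational.Properties as ℚP
open import Data.Bool using (Bool; true; false; T; _∧_; _∨_)
open import Data.Bool.Properties using (∧-zeroʳ; T-∧; T-∨)
import Data.Bool.ListAction as BoolList
open import Data.Fin using (Fin; zero; suc) renaming (_≟_ to _≟ᶠ_)
open import Data.Fin.Properties using (suc-injective)
open import Data.Fin.Subset using (Subset; ⊤; ⁅_⁆; _∪_; _-_; _∈_; _⊆_; ∣_∣)
import Data.Fin.Subset.Properties as SubP
open import Data.List using (List; []; _∷_; _++_; map; take; length; filterᵇ)
import Data.List.Properties as ListP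
open import Data.List.Membership.Propositional using () renaming (_∈_ to _∈ˡ_)
open import Data.List.Relation.Unary.Any using (here; there)
open import Data.List.Relation.Unary.All as All using (All; []; _∷_)
import Data.Vec as Vec
open import Data.Vec using () renaming (here to hereᵛ; there to thereᵛ)
open import Data.Empty using (⊥-elim) renaming (⊥ to Empty)
open import Data.Product using (_×_; _,_; proj₁; proj₂; ∃-syntax)
open import Data.Sum using (inj₁; inj₂)
open import Function using (Equivalence)
open import Relation.Nullary using (¬_; yes; no)
open import Relation.Binary.PropositionalEquality
  using (_≡_; _≢_; refl; sym; trans; cong; cong₂; subst; module ≡-Reasoning)

open Equivalence using (to; from)

count : ∀ {A : Set} → (A → Bool) → List A → ℕ
count p xs = length (filterᵇ p xs)

count-cong : ∀ {A : Set} {p q : A → Bool} (xs : List A) → (∀ x → p x ≡ q x) →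
  count p xs ≡ count q xs
count-cong [] p≗q = refl
count-cong {p = p} {q} (x ∷ xs) p≗q with p x | q x | p≗q x
... | true  | .true  | refl = cong suc (count-cong xs p≗q)
... | false | .false | refl = count-cong xs p≗q

count-++ : ∀ {A : Set} (p : A → Bool) (xs ys : List A) →
  count p (xs ++ ys) ≡ count p xs ℕ.+ count p ys
count-++ p [] ys = refl
count-++ p (x ∷ xs) ys with p x
... | true  = cong suc (count-++ p xs ys)
... | false = count-++ p xs ys

count-map : ∀ {A B : Set} (p : B → Bool) (f : A → B) (xs : List A) →
  count p (map f xs) ≡ count (λ x → p (f x)) xs
count-map p f [] = refl
count-map p f (x ∷ xs) with p (f x)
... | true  = cong suc (count-map p f xs)
... | false = count-map p f xs

count-none : ∀ {A : Set} (p : A → Bool) (xs : List A) → (∀ x → p x ≡ false) → count p xs ≡ 0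
count-none p [] none = refl
count-none p (x ∷ xs) none with p x | none x
... | false | refl = count-none p xs none

count-∨ : ∀ {A : Set} (p q : A → Bool) (xs : List A) → (∀ x → T (p x) → T (q x) → Empty) →
  count (λ x → p x ∨ q x) xs ≡ count p xs ℕ.+ count q xs
count-∨ p q [] disjoint = refl
count-∨ p q (x ∷ xs) disjoint with p x | q x | disjoint x
... | true  | true  | d = ⊥-elim (d _ _)
... | true  | false | _ = cong suc (count-∨ p q xs disjoint)
... | false | true  | _ = trans (cong suc (count-∨ p q xs disjoint)) (sym (ℕP.+-suc (count p xs) (count q xs)))
... | false | false | _ = count-∨ p q xs disjoint

T-ext : ∀ {a b : Bool} → (T a → T b) → (T b → T a) → a ≡ b
T-ext {true}  {true}  _ _ = refl
T-ext {true}  {false} a⇒b _ = ⊥-elim (a⇒b _)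
T-ext {false} {true}  _ b⇒a = ⊥-elim (b⇒a _)
T-ext {false} {false} _ _ = refl

_⊆ᵇ_ : ∀ {n} → Subset n → Subset n → Bool
Vec.[] ⊆ᵇ Vec.[] = true
(true Vec.∷ e) ⊆ᵇ (b Vec.∷ W) = b ∧ (e ⊆ᵇ W)
(false Vec.∷ e) ⊆ᵇ (b Vec.∷ W) = e ⊆ᵇ W

⊆ᵇ-sound : ∀ {n} (e W : Subset n) → T (e ⊆ᵇ W) → e ⊆ W
⊆ᵇ-sound (true Vec.∷ e) (true Vec.∷ W) t hereᵛ = hereᵛ
⊆ᵇ-sound (true Vec.∷ e) (true Vec.∷ W) t (thereᵛ x∈e) = thereᵛ (⊆ᵇ-sound e W t x∈e)
⊆ᵇ-sound (false Vec.∷ e) (b Vec.∷ W) t (thereᵛ x∈e) = thereᵛ (⊆ᵇ-sound e W t x∈e)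

⊆ᵇ-complete : ∀ {n} (e W : Subset n) → e ⊆ W → T (e ⊆ᵇ W)
⊆ᵇ-complete Vec.[] Vec.[] e⊆W = _
⊆ᵇ-complete (true Vec.∷ e) (true Vec.∷ W) e⊆W = ⊆ᵇ-complete e W (SubP.drop-∷-⊆ e⊆W)
⊆ᵇ-complete (true Vec.∷ e) (false Vec.∷ W) e⊆W with e⊆W hereᵛ
... | ()
⊆ᵇ-complete (false Vec.∷ e) (b Vec.∷ W) e⊆W = ⊆ᵇ-complete e W (SubP.drop-∷-⊆ e⊆W)

kSubsets : ∀ {n} → ℕ → Subset n → EdgeSet n
kSubsets k W e = (∣ e ∣ ≡ᵇ k) ∧ (e ⊆ᵇ W)

kSubsets-elim : ∀ {n} k (W e : Subset n) → T (kSubsets k W e) → (∣ e ∣ ≡ k) × (e ⊆ W)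
kSubsets-elim k W e t with to T-∧ t
... | size , sub = ℕP.≡ᵇ⇒≡ ∣ e ∣ k size , ⊆ᵇ-sound e W sub

kSubsets-intro : ∀ {n} k (W e : Subset n) → ∣ e ∣ ≡ k → e ⊆ W → T (kSubsets k W e)
kSubsets-intro k W e size sub = from T-∧ (ℕP.≡⇒≡ᵇ ∣ e ∣ k size , ⊆ᵇ-complete e W sub)

-- A set W has exactly ∣ W ∣ C k subsets of size k (Pascal's rule, by
-- splitting on whether the first vertex is in the subset).
card-kSubsets : ∀ n k (W : Subset n) → card (kSubsets k W) ≡ ∣ W ∣ C k
card-kSubsets zero zero Vec.[] = refl
card-kSubsets zero (suc k) Vec.[] = refl
card-kSubsets (suc n) k (b Vec.∷ W) = begin
  count E (map (true Vec.∷_) S ++ map (false Vec.∷_) S)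
    ≡⟨ count-++ E (map (true Vec.∷_) S) (map (false Vec.∷_) S) ⟩
  count E (map (true Vec.∷_) S) ℕ.+ count E (map (false Vec.∷_) S)
    ≡⟨ cong₂ ℕ._+_ (count-map E (true Vec.∷_) S) (count-map E (false Vec.∷_) S) ⟩
  count (λ e → E (true Vec.∷ e)) S ℕ.+ count (λ e → E (false Vec.∷ e)) S
    ≡⟨ pascal b k ⟩
  ∣ b Vec.∷ W ∣ C k ∎
  where
  open ≡-Reasoning
  S : List (Subset n)
  S = allSubsets n
  E : EdgeSet (suc n)
  E = kSubsets k (b Vec.∷ W)
  -- Subsets containing the first vertex contribute ∣ W ∣ C (k - 1) if it
  -- lies in W and none otherwise; the others contribute ∣ W ∣ C k.
  pascal : ∀ b k → count (λ e → kSubsets k (b Vec.∷ W) (true Vec.∷ e)) S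
                   ℕ.+ count (λ e → kSubsets k (b Vec.∷ W) (false Vec.∷ e)) S ≡ ∣ b Vec.∷ W ∣ C k
  pascal true zero = cong₂ ℕ._+_ (count-none _ S (λ _ → refl)) (card-kSubsets n zero W)
  pascal true (suc k) = trans (cong₂ ℕ._+_ (card-kSubsets n k W) (card-kSubsets n (suc k) W))
                              (nCk+nC[k+1]≡[n+1]C[k+1] ∣ W ∣ k)
  pascal false k = cong₂ ℕ._+_ (count-none _ S (λ e → ∧-zeroʳ (suc ∣ e ∣ ≡ᵇ k))) (card-kSubsets n k W)

⋃-suc : ∀ {n m} (Q : Fin (suc m) → EdgeSet n) e → ⋃ Q e ≡ Q zero e ∨ ⋃ (λ i → Q (suc i)) e
⋃-suc Q e = cong (λ bs → Q zero e ∨ BoolList.or bs)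
  (trans (ListP.map-tabulate suc (λ i → Q i e)) (sym (ListP.map-tabulate (λ i → i) (λ i → Q (suc i) e))))

⋃-elim : ∀ {n m} (Q : Fin m → EdgeSet n) e → T (⋃ Q e) → ∃[ i ] T (Q i e)
⋃-elim {m = zero} Q e ()
⋃-elim {m = suc m} Q e t rewrite ⋃-suc Q e with to T-∨ t
... | inj₁ t₀ = zero , t₀
... | inj₂ t₊ with ⋃-elim (λ i → Q (suc i)) e t₊
...   | i , tᵢ = suc i , tᵢ

⋃-intro : ∀ {n m} (Q : Fin m → EdgeSet n) e i → T (Q i e) → T (⋃ Q e)
⋃-intro {m = suc m} Q e zero t rewrite ⋃-suc Q e = from T-∨ (inj₁ t)
⋃-intro {m = suc m} Q e (suc i) t rewrite ⋃-suc Q e =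
  from T-∨ (inj₂ (⋃-intro (λ i → Q (suc i)) e i t))

sumFin : ∀ m → (Fin m → ℕ) → ℕ
sumFin zero f = 0
sumFin (suc m) f = f zero ℕ.+ sumFin m (λ i → f (suc i))

sumFin-const : ∀ m (f : Fin m → ℕ) c → (∀ i → f i ≡ c) → sumFin m f ≡ m ℕ.* c
sumFin-const zero f c f≡c = refl
sumFin-const (suc m) f c f≡c = cong₂ ℕ._+_ (f≡c zero) (sumFin-const m (λ i → f (suc i)) c (λ i → f≡c (suc i)))

card-⋃-disjoint : ∀ {n m} (Q : Fin m → EdgeSet n) → (∀ i j e → T (Q i e) → T (Q j e) → i ≡ j) →
  card (⋃ Q) ≡ sumFin m (λ i → card (Q i))
card-⋃-disjoint {n} {zero} Q disjoint = count-none _ (allSubsets n) (λ _ → refl)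
card-⋃-disjoint {n} {suc m} Q disjoint = begin
  card (⋃ Q)                                         ≡⟨ count-cong (allSubsets n) (⋃-suc Q) ⟩
  count (λ e → Q zero e ∨ ⋃ Q₊ e) (allSubsets n)      ≡⟨ count-∨ (Q zero) (⋃ Q₊) (allSubsets n) head-apart ⟩
  card (Q zero) ℕ.+ card (⋃ Q₊)                       ≡⟨ cong (card (Q zero) ℕ.+_) (card-⋃-disjoint Q₊ disjoint₊) ⟩
  sumFin (suc m) (λ i → card (Q i))                  ∎
  where
  open ≡-Reasoning
  Q₊ : Fin m → EdgeSet n
  Q₊ i = Q (suc i)
  disjoint₊ : ∀ i j e → T (Q₊ i e) → T (Q₊ j e) → i ≡ j
  disjoint₊ i j e tᵢ tⱼ = suc-injective (disjoint (suc i) (suc j) e tᵢ tⱼ)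
  head-apart : ∀ e → T (Q zero e) → T (⋃ Q₊ e) → Empty
  head-apart e t₀ t₊ with ⋃-elim Q₊ e t₊
  ... | j , tⱼ with disjoint zero (suc j) e t₀ tⱼ
  ...   | ()

-- ℕtoℚ c is already in normal form, which makes ℕtoℚ additive.
ℕtoℚ-normal : ∀ c → ℕtoℚ c ≡ mkℚ (+ c) 0 (coprime-sym (1-coprimeTo c))
ℕtoℚ-normal c = ℚP.normalize-coprime (coprime-sym (1-coprimeTo c))

ℕtoℚ-+ : ∀ a b → ℕtoℚ (a ℕ.+ b) ≡ ℕtoℚ a + ℕtoℚ b
ℕtoℚ-+ a b rewrite ℕtoℚ-normal a | ℕtoℚ-normal b =
  cong (_/ 1) (sym (cong₂ ℤ._+_ (ℤP.*-identityʳ (+ a)) (ℤP.*-identityʳ (+ b))))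

ℕtoℚ-sumFin : ∀ m (f : Fin m → ℕ) c α → (∀ i → ℕtoℚ (f i) ≡ α * ℕtoℚ c) →
  ℕtoℚ (sumFin m f) ≡ α * ℕtoℚ (m ℕ.* c)
ℕtoℚ-sumFin zero f c α f≡αc = sym (ℚP.*-zeroʳ α)
ℕtoℚ-sumFin (suc m) f c α f≡αc = begin
  ℕtoℚ (f zero ℕ.+ sumFin m f₊)            ≡⟨ ℕtoℚ-+ (f zero) (sumFin m f₊) ⟩
  ℕtoℚ (f zero) + ℕtoℚ (sumFin m f₊)       ≡⟨ cong₂ _+_ (f≡αc zero) (ℕtoℚ-sumFin m f₊ c α (λ i → f≡αc (suc i))) ⟩
  α * ℕtoℚ c + α * ℕtoℚ (m ℕ.* c)          ≡⟨ ℚP.*-distribˡ-+ α (ℕtoℚ c) (ℕtoℚ (m ℕ.* c)) ⟨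
  α * (ℕtoℚ c + ℕtoℚ (m ℕ.* c))            ≡⟨ cong (α *_) (ℕtoℚ-+ c (m ℕ.* c)) ⟨
  α * ℕtoℚ (suc m ℕ.* c)                   ∎
  where
  open ≡-Reasoning
  f₊ : Fin m → ℕ
  f₊ i = f (suc i)

point-of-nonempty : ∀ {n} (p : Subset n) → 1 ≤ ∣ p ∣ → ∃[ a ] a ∈ p
point-of-nonempty (true Vec.∷ p) _ = zero , hereᵛ
point-of-nonempty (false Vec.∷ p) size with point-of-nonempty p size
... | a , a∈p = suc a , thereᵛ a∈p

two-points : ∀ {n} (p : Subset n) → 2 ≤ ∣ p ∣ → ∃[ a ] ∃[ b ] (a ≢ b × a ∈ p × b ∈ p)
two-points (true Vec.∷ p) (s≤s size) with point-of-nonempty p size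
... | b , b∈p = zero , suc b , (λ ()) , hereᵛ , thereᵛ b∈p
two-points (false Vec.∷ p) size with two-points p size
... | a , b , a≢b , a∈p , b∈p = suc a , suc b , (λ eq → a≢b (suc-injective eq)) , thereᵛ a∈p , thereᵛ b∈p

-- Three distinct points force size at least three: removing a and then b
-- each lowers the size, and c still remains.
three-points : ∀ {n} (p : Subset n) {a b c} → a ≢ b → a ≢ c → b ≢ c →
  a ∈ p → b ∈ p → c ∈ p → 3 ≤ ∣ p ∣
three-points p {a} {b} {c} a≢b a≢c b≢c a∈p b∈p c∈p = begin
  3                     ≤⟨ s≤s (s≤s (ℕP.≤-trans (s≤s z≤n) (SubP.x∈p⇒∣p-x∣<∣p∣ c∈p-a-b))) ⟩
  suc (suc ∣ p - a - b ∣) ≤⟨ s≤s (SubP.x∈p⇒∣p-x∣<∣p∣ b∈p-a) ⟩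
  suc ∣ p - a ∣           ≤⟨ SubP.x∈p⇒∣p-x∣<∣p∣ a∈p ⟩
  ∣ p ∣                   ∎
  where
  open ℕP.≤-Reasoning
  b∈p-a : b ∈ p - a
  b∈p-a = SubP.x∈p∧x≢y⇒x∈p-y b∈p (λ eq → a≢b (sym eq))
  c∈p-a-b : c ∈ p - a - b
  c∈p-a-b = SubP.x∈p∧x≢y⇒x∈p-y (SubP.x∈p∧x≢y⇒x∈p-y c∈p (λ eq → a≢c (sym eq))) (λ eq → b≢c (sym eq))

∣⁅x⁆∪s∣≤1+∣s∣ : ∀ {n} (x : Fin n) (s : Subset n) → ∣ ⁅ x ⁆ ∪ s ∣ ≤ suc ∣ s ∣
∣⁅x⁆∪s∣≤1+∣s∣ zero (b Vec.∷ s) rewrite SubP.∪-identityˡ s = s≤s (SubP.∣p∣≤∣x∷p∣ b s)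
∣⁅x⁆∪s∣≤1+∣s∣ (suc x) (true Vec.∷ s) = s≤s (∣⁅x⁆∪s∣≤1+∣s∣ x s)
∣⁅x⁆∪s∣≤1+∣s∣ (suc x) (false Vec.∷ s) = ∣⁅x⁆∪s∣≤1+∣s∣ x s

∈ˡ⇒∈toSubset : ∀ {n} {x : Fin n} {w} → x ∈ˡ w → x ∈ toSubset w
∈ˡ⇒∈toSubset {w = y ∷ w} (here refl) = SubP.x∈p∪q⁺ (inj₁ (SubP.x∈⁅x⁆ y))
∈ˡ⇒∈toSubset {w = y ∷ w} (there x∈w) = SubP.x∈p∪q⁺ (inj₂ (∈ˡ⇒∈toSubset x∈w))

∈toSubset⇒∈ˡ : ∀ {n} {x : Fin n} w → x ∈ toSubset w → x ∈ˡ w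
∈toSubset⇒∈ˡ [] x∈⊥ = ⊥-elim (SubP.∉⊥ x∈⊥)
∈toSubset⇒∈ˡ (y ∷ w) x∈ with SubP.x∈p∪q⁻ ⁅ y ⁆ (toSubset w) x∈
... | inj₁ x∈⁅y⁆ = here (SubP.x∈⁅y⁆⇒x≡y y x∈⁅y⁆)
... | inj₂ x∈w = there (∈toSubset⇒∈ˡ w x∈w)

toSubset-mono : ∀ {n} {u w : List (Fin n)} → (∀ {x} → x ∈ˡ u → x ∈ˡ w) → toSubset u ⊆ toSubset w
toSubset-mono {u = u} u⊆w x∈u = ∈ˡ⇒∈toSubset (u⊆w (∈toSubset⇒∈ˡ u x∈u))

take-⊆-take-suc : ∀ {A : Set} {a : A} k xs → a ∈ˡ take k xs → a ∈ˡ take (suc k) xs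
take-⊆-take-suc (suc k) (y ∷ ys) (here eq) = here eq
take-⊆-take-suc (suc k) (y ∷ ys) (there a∈) = there (take-⊆-take-suc k ys a∈)

head∈take : ∀ {A : Set} k (x : A) xs → 1 ≤ k → x ∈ˡ take k (x ∷ xs)
head∈take (suc k) x xs _ = here refl

windows-short : ∀ {A : Set} k (xs : List A) → ¬ (k ≤ length xs) → windows k xs ≡ []
windows-short k [] _ = refl
windows-short k (x ∷ xs) short with k ≤? length (x ∷ xs)
... | yes long = ⊥-elim (short long)
... | no _ = refl

first-window : ∀ {A : Set} {P : List A → Set} k (xs : List A) → 1 ≤ k → k ≤ length xs →
  All P (windows k xs) → P (take k xs)
first-window (suc k) [] _ () _
first-window k (x ∷ xs) _ long all with k ≤? length (x ∷ xs)
... | yes _ = All.head all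
... | no short = ⊥-elim (short long)

_⊆ₑ_ : ∀ {n} → EdgeSet n → EdgeSet n → Set
E ⊆ₑ E' = ∀ f → T (E f) → T (E' f)

_∩ₑ_ : ∀ {n} → EdgeSet n → EdgeSet n → EdgeSet n
(E ∩ₑ E') f = E f ∧ E' f

∩ₑ-⊆ˡ : ∀ {n} (E E' : EdgeSet n) → (E ∩ₑ E') ⊆ₑ E
∩ₑ-⊆ˡ E E' f t = proj₁ (to (T-∧ {E f} {E' f}) t)

∖ₑ-⊆ : ∀ {n} (E : EdgeSet n) e → (E ∖ₑ e) ⊆ₑ E
∖ₑ-⊆ E e f t = proj₁ (to (T-∧ {E f}) t)

∩ₑ-∖ₑ : ∀ {n} (E E' : EdgeSet n) e → (E ∩ₑ (E' ∖ₑ e)) ⊆ₑ (E ∖ₑ e)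
∩ₑ-∖ₑ E E' e f t with to (T-∧ {E f}) t
... | f∈E , f∈E'∖e = from (T-∧ {E f}) (f∈E , proj₂ (to (T-∧ {E' f}) f∈E'∖e))

WindowSeq-mono : ∀ {n k} {W W' : Subset n} {E E' : EdgeSet n} {vs} →
  All (_∈ W') vs → E ⊆ₑ E' → WindowSeq k W E vs → WindowSeq k W' E' vs
WindowSeq-mono inW' E⊆E' ws = record
  { long = long ; inW = inW' ; kSets = kSets ; distinct = distinct
  ; inE = All.map (λ {w} → E⊆E' (toSubset w)) inE }
  where open WindowSeq ws

SemicycleFree-mono : ∀ {n k} {W : Subset n} {E E' : EdgeSet n} →
  E ⊆ₑ E' → SemicycleFree k W E' → SemicycleFree k W E
SemicycleFree-mono E⊆E' free v ws (seq , closed) =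
  free v ws (WindowSeq-mono (WindowSeq.inW seq) E⊆E' seq , closed)

module SteinerDecomposition {n l m : ℕ} (B : Fin m → Subset n) (steiner : IsSteinerSystem n l m B) where

  block-unique : ∀ {a b} i j → a ≢ b → a ∈ B i → b ∈ B i → a ∈ B j → b ∈ B j → i ≡ j
  block-unique i j a≢b a∈i b∈i a∈j b∈j with proj₂ (proj₂ steiner) _ _ a≢b
  ... | _ , _ , only = trans (only i a∈i b∈i) (sym (only j a∈j b∈j))

  block-unique-set : ∀ {s} i j → 2 ≤ ∣ s ∣ → s ⊆ B i → s ⊆ B j → i ≡ j
  block-unique-set {s} i j size s⊆i s⊆j with two-points s size
  ... | a , b , a≢b , a∈s , b∈s = block-unique i j a≢b (s⊆i a∈s) (s⊆i b∈s) (s⊆j a∈s) (s⊆j b∈s)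

  pair-in-block : ∀ e → ∣ e ∣ ≡ 2 → ∃[ i ] e ⊆ B i
  pair-in-block e size with two-points e (ℕP.≤-reflexive (sym size))
  ... | a , b , a≢b , a∈e , b∈e with proj₂ (proj₂ steiner) a b a≢b
  ...   | i , (a∈i , b∈i) , _ = i , e⊆i
    where
    e⊆i : e ⊆ B i
    e⊆i {z} z∈e with z ≟ᶠ a | z ≟ᶠ b
    ... | yes refl | _ = a∈i
    ... | no _ | yes refl = b∈i
    ... | no z≢a | no z≢b = ⊥-elim (ℕP.<-irrefl refl (ℕP.≤-trans
          (three-points e a≢b (λ eq → z≢a (sym eq)) (λ eq → z≢b (sym eq)) a∈e b∈e z∈e)
          (ℕP.≤-reflexive size)))

  -- Double counting of pairs: the 2-subsets of the vertex set are the
  -- disjoint union of the 2-subsets of the blocks, so n C 2 = m · (l C 2).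
  blockPairs : Fin m → EdgeSet n
  blockPairs i = kSubsets 2 (B i)

  pairs-of-blocks : ∀ e → kSubsets 2 ⊤ e ≡ ⋃ blockPairs e
  pairs-of-blocks e = T-ext into-block into-⊤
    where
    into-block : T (kSubsets 2 ⊤ e) → T (⋃ blockPairs e)
    into-block t with kSubsets-elim 2 ⊤ e t
    ... | size , _ with pair-in-block e size
    ...   | i , e⊆i = ⋃-intro blockPairs e i (kSubsets-intro 2 (B i) e size e⊆i)
    into-⊤ : T (⋃ blockPairs e) → T (kSubsets 2 ⊤ e)
    into-⊤ t with ⋃-elim blockPairs e t
    ... | i , tᵢ = kSubsets-intro 2 ⊤ e (proj₁ (kSubsets-elim 2 (B i) e tᵢ)) (λ _ → SubP.∈⊤)

  pair-count : m ℕ.* (l C 2) ≡ n C 2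
  pair-count = sym (begin
    n C 2                                  ≡⟨ cong (_C 2) (SubP.∣⊤∣≡n n) ⟨
    ∣ ⊤ {n} ∣ C 2                          ≡⟨ card-kSubsets n 2 ⊤ ⟨
    card {n} (kSubsets 2 ⊤)                ≡⟨ count-cong (allSubsets n) pairs-of-blocks ⟩
    card (⋃ blockPairs)                       ≡⟨ card-⋃-disjoint blockPairs blockPairs-disjoint ⟩
    sumFin m (λ i → card (blockPairs i))      ≡⟨ sumFin-const m _ (l C 2) blockPairs-count ⟩
    m ℕ.* (l C 2)                          ∎)
    where
    open ≡-Reasoning
    blockPairs-disjoint : ∀ i j e → T (blockPairs i e) → T (blockPairs j e) → i ≡ j
    blockPairs-disjoint i j e tᵢ tⱼ with kSubsets-elim 2 (B i) e tᵢ | kSubsets-elim 2 (B j) e tⱼ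
    ... | size , e⊆i | _ , e⊆j = block-unique-set i j (ℕP.≤-reflexive (sym size)) e⊆i e⊆j
    blockPairs-count : ∀ i → card (blockPairs i) ≡ l C 2
    blockPairs-count i = trans (card-kSubsets n 2 (B i)) (cong (_C 2) (proj₁ steiner i))

  module UniformFamily {k : ℕ} (Ed : Fin m → EdgeSet n) (uniform : ∀ i → IsUniform k (B i) (Ed i)) where

    edge⊆block : ∀ i e → T (Ed i e) → e ⊆ B i
    edge⊆block i e t = proj₁ (uniform i e t)

    -- For k ≥ 2 an edge determines its block, so the Ed i are disjoint.
    edges-disjoint : 2 ≤ k → ∀ i j e → T (Ed i e) → T (Ed j e) → i ≡ j
    edges-disjoint 2≤k i j e tᵢ tⱼ =
      block-unique-set i j (ℕP.≤-trans 2≤k (ℕP.≤-reflexive (sym (proj₂ (uniform i e tᵢ)))))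
        (edge⊆block i e tᵢ) (edge⊆block j e tⱼ)

    card-⋃-proportional : 2 ≤ k → (α : ℚ) → (∀ i → ℕtoℚ (card (Ed i)) ≡ α * ℕtoℚ (l C 2)) →
      ℕtoℚ (card (⋃ Ed)) ≡ α * ℕtoℚ (n C 2)
    card-⋃-proportional 2≤k α proportional = begin
      ℕtoℚ (card (⋃ Ed))                     ≡⟨ cong ℕtoℚ (card-⋃-disjoint Ed (edges-disjoint 2≤k)) ⟩
      ℕtoℚ (sumFin m (λ i → card (Ed i)))    ≡⟨ ℕtoℚ-sumFin m _ (l C 2) α proportional ⟩
      α * ℕtoℚ (m ℕ.* (l C 2))               ≡⟨ cong (λ c → α * ℕtoℚ c) pair-count ⟩
      α * ℕtoℚ (n C 2)                       ∎
      where open ≡-Reasoning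

    -- Two consecutive k-windows x ∷ t and take k xs (t = take (k - 1) xs)
    -- share the k - 1 ≥ 2 vertices of t, so they lie in the same block.
    consecutive-windows : 3 ≤ k → ∀ x xs i j → ∣ toSubset (take k (x ∷ xs)) ∣ ≡ k →
      toSubset (take k (x ∷ xs)) ⊆ B j → toSubset (take k xs) ⊆ B i → j ≡ i
    consecutive-windows (s≤s 2≤k') x xs i j size first⊆j second⊆i =
      block-unique-set j i 2≤∣t∣ (λ a∈t → first⊆j (toSubset-mono {u = t} there a∈t))
                                  (λ a∈t → second⊆i (toSubset-mono {u = t} (take-⊆-take-suc _ xs) a∈t))
      where
      t : List (Fin n)
      t = take (ℕ.pred k) xs
      2≤∣t∣ : 2 ≤ ∣ toSubset t ∣
      2≤∣t∣ = ℕP.≤-trans 2≤k' (ℕP.≤-pred (ℕP.≤-trans (ℕP.≤-reflexive (sym size)) (∣⁅x⁆∪s∣≤1+∣s∣ x (toSubset t))))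

    windows-in-one-block : 3 ≤ k → ∀ vs → k ≤ length vs →
      All (λ w → ∣ toSubset w ∣ ≡ k) (windows k vs) →
      All (λ w → T (⋃ Ed (toSubset w))) (windows k vs) →
      ∃[ i ] (All (λ w → T (Ed i (toSubset w))) (windows k vs) × All (_∈ B i) vs)
    windows-in-one-block (s≤s _) [] () _ _
    windows-in-one-block 3≤k (x ∷ xs) long sizes inUnion with k ≤? length (x ∷ xs)
    windows-in-one-block 3≤k (x ∷ xs) long sizes inUnion | no short = ⊥-elim (short long)
    windows-in-one-block 3≤k (x ∷ xs) long (size ∷ sizes) (first ∷ rest) | yes _
      with ⋃-elim Ed _ first | k ≤? length xs
    ... | j , first∈j | no short =
      j , first∈j ∷ subst (All _) (sym (windows-short k xs short)) [] , All.tabulate x∷xs⊆j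
      where
      x∷xs⊆j : ∀ {z} → z ∈ˡ x ∷ xs → z ∈ B j
      x∷xs⊆j {z} z∈ = edge⊆block j _ first∈j
        (∈ˡ⇒∈toSubset (subst (z ∈ˡ_) (sym (ListP.take-all k (x ∷ xs) (ℕP.≰⇒> short))) z∈))
    ... | j , first∈j | yes long′ with windows-in-one-block 3≤k xs long′ sizes rest
    ...   | i , rest∈i , xs⊆i = i , subst (λ b → T (Ed b _)) j≡i first∈j ∷ rest∈i , x∈i ∷ xs⊆i
      where
      first⊆j : toSubset (take k (x ∷ xs)) ⊆ B j
      first⊆j = edge⊆block j _ first∈j
      j≡i : j ≡ i
      j≡i = consecutive-windows 3≤k x xs i j size first⊆j
              (edge⊆block i _ (first-window k xs (ℕP.≤-trans (s≤s z≤n) 3≤k) long′ rest∈i))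
      x∈i : x ∈ B i
      x∈i = subst (λ b → x ∈ B b) j≡i (first⊆j (∈ˡ⇒∈toSubset (head∈take k x xs (ℕP.≤-trans (s≤s z≤n) 3≤k))))

    localise : 3 ≤ k → ∀ {W} {E : EdgeSet n} {vs} → E ⊆ₑ ⋃ Ed →
      WindowSeq k W E vs → ∃[ i ] WindowSeq k (B i) (Ed i ∩ₑ E) vs
    localise 3≤k {vs = vs} E⊆⋃ seq
      with windows-in-one-block 3≤k vs long kSets (All.map (λ {w} → E⊆⋃ (toSubset w)) inE)
      where open WindowSeq seq
    ... | i , inEdᵢ , inBᵢ = i , record
      { long = long ; inW = inBᵢ ; kSets = kSets ; distinct = distinct
      ; inE = All.zipWith (λ (a , b) → from T-∧ (a , b)) (inEdᵢ , inE) }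
      where open WindowSeq seq

    ⋃-uniform : IsUniform k ⊤ (⋃ Ed)
    ⋃-uniform e t with ⋃-elim Ed e t
    ... | i , tᵢ = (λ _ → SubP.∈⊤) , proj₂ (uniform i e tᵢ)

    -- Two vertices lie in a common block, and a chain of that F i
    -- joining them is a chain of the union.
    ⋃-chainConnected : (∀ i → ChainConnected k (B i) (Ed i)) → ChainConnected k ⊤ (⋃ Ed)
    ⋃-chainConnected connected x y _ _ x≢y with proj₂ (proj₂ steiner) x y x≢y
    ... | i , (x∈i , y∈i) , _ with connected i x y x∈i y∈i x≢y
    ...   | v , ws , (seq , open′) , x∈ , y∈ =
      v , ws , (WindowSeq-mono (All.tabulate (λ _ → SubP.∈⊤)) (λ f → ⋃-intro Ed f i) seq , open′) , x∈ , y∈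

    ⋃-semicycleFree : 3 ≤ k → (∀ i → SemicycleFree k (B i) (Ed i)) → SemicycleFree k ⊤ (⋃ Ed)
    ⋃-semicycleFree 3≤k free v ws (seq , closed) with localise 3≤k (λ _ t → t) seq
    ... | i , seqᵢ = free i v ws (WindowSeq-mono (WindowSeq.inW seqᵢ) (∩ₑ-⊆ˡ (Ed i) (⋃ Ed)) seqᵢ , closed)

    -- If removing an edge e of F j left the union a hypertree, then F j
    -- without e would be a hypertree: its chains are localised chains of
    -- the union, which must lie in B j since they join two vertices of B j.
    ⋃-edgeMinimal : 3 ≤ k → (∀ i → IsEdgeMinimalHypertree k (B i) (Ed i)) →
      ∀ e → T (⋃ Ed e) → ¬ IsHypertree k ⊤ (⋃ Ed ∖ₑ e)
    ⋃-edgeMinimal 3≤k minimal e e∈⋃ (_ , connected , _) with ⋃-elim Ed e e∈⋃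
    ... | j , e∈j = proj₂ (minimal j) e e∈j (uniformⱼ , connectedⱼ , freeⱼ)
      where
      uniformⱼ : IsUniform k (B j) (Ed j ∖ₑ e)
      uniformⱼ f t = uniform j f ((∖ₑ-⊆ (Ed j) e) f t)
      freeⱼ : SemicycleFree k (B j) (Ed j ∖ₑ e)
      freeⱼ = SemicycleFree-mono (∖ₑ-⊆ (Ed j) e) (proj₂ (proj₂ (proj₁ (minimal j))))
      connectedⱼ : ChainConnected k (B j) (Ed j ∖ₑ e)
      connectedⱼ x y x∈j y∈j x≢y with connected x y SubP.∈⊤ SubP.∈⊤ x≢y
      ... | v , ws , (seq , open′) , x∈ , y∈ with localise 3≤k (∖ₑ-⊆ (⋃ Ed) e) seq
      ...   | i , seqᵢ with block-unique i j x≢y (All.lookup (WindowSeq.inW seqᵢ) x∈)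
                             (All.lookup (WindowSeq.inW seqᵢ) y∈) x∈j y∈j
      ...     | refl = v , ws , (WindowSeq-mono (WindowSeq.inW seqᵢ) (∩ₑ-∖ₑ (Ed i) (⋃ Ed) e) seqᵢ , open′) , x∈ , y∈

theorem11 : ∀ {n l m k : ℕ} (B : Fin m → Subset n) → IsSteinerSystem n l m B →
    3 ≤ k → (Ed : Fin m → EdgeSet n) → (∀ i → IsUniform k (B i) (Ed i)) →
    ((α : ℚ) → (∀ i → ℕtoℚ (card (Ed i)) ≡ α * ℕtoℚ (l C 2)) →
       ℕtoℚ (card (⋃ Ed)) ≡ α * ℕtoℚ (n C 2))
    × ((∀ i → IsEdgeMinimalHypertree k (B i) (Ed i)) →
       IsEdgeMinimalHypertree k ⊤ (⋃ Ed))
theorem11 B steiner 3≤k Ed uniform =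
  card-⋃-proportional (ℕP.≤-trans (ℕP.n≤1+n 2) 3≤k) , minimal-union
  where
  open SteinerDecomposition B steiner
  open UniformFamily Ed uniform
  minimal-union : (∀ i → IsEdgeMinimalHypertree _ (B i) (Ed i)) → IsEdgeMinimalHypertree _ ⊤ (⋃ Ed)
  minimal-union minimal =
    ( ⋃-uniform
    , ⋃-chainConnected (λ i → proj₁ (proj₂ (proj₁ (minimal i))))
    , ⋃-semicycleFree 3≤k (λ i → proj₂ (proj₂ (proj₁ (minimal i)))) )
    , ⋃-edgeMinimal 3≤k minimal
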